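{- $R(B_2, B_9) \geq 22$.
   Context: For graphs $G,H$, the Ramsey number $R(G,H)$ is the smallest $n$ such that every red-blue edge-coloring of $K_n$ contains a red copy of $G$ or a blue copy of $H$ (copies as subgraphs, not necessarily induced). The book $B_k$ is the graph on $k+2$ vertices consisting of an edge $uv$ together with $k$ further vertices, each adjacent exactly to $u$ and $v$. -}

module Defs where

open import Data.Nat using (ℕ; _<_; _+_)
open import Data.Fin using (Fin; toℕ)
open import Data.Product using (Σ; _×_)
open import Data.Sum using (_⊎_)
open import Relation.Binary.PropositionalEquality using (_≡_; _≢_)
open import Function.Definitions using (Injective)

record Graph : Set₁ where
  field
    v   : ℕ
    Adj : Fin v → Fin v → Set

data Colour : Set where
  red blue : Colour

-- A red-blue edge-colouring of the complete graph K_n on vertex set Fin n: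
-- a colour for every pair, symmetric (the diagonal values are irrelevant).
record Colouring (n : ℕ) : Set where
  field
    col : Fin n → Fin n → Colour
    sym : ∀ i j → col i j ≡ col j i

-- A copy of G (as a subgraph, not necessarily induced) in K_n all of whose
-- edges receive colour κ: an injective vertex map sending edges to κ-edges.
MonoCopy : ∀ {n} → Colouring n → Colour → Graph → Set
MonoCopy {n} c κ G =
  Σ (Fin (Graph.v G) → Fin n) λ f →
    Injective _≡_ _≡_ f ×
    (∀ i j → Graph.Adj G i j → Colouring.col c (f i) (f j) ≡ κ)

Arrows : ℕ → Graph → Graph → Set
Arrows n G H = (c : Colouring n) → MonoCopy c red G ⊎ MonoCopy c blue H

-- R(G,H) ≥ m : every n with K_n → (G,H) satisfies n ≥ m
-- (R(G,H) is the least such n).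
RamseyAtLeast : Graph → Graph → ℕ → Set
RamseyAtLeast G H m = ∀ n → Arrows n G H → m Data.Nat.≤ n

-- Book B_k on vertices Fin (k + 2): vertices 0,1 form the spine uv,
-- every other vertex is adjacent exactly to 0 and 1.
Book : ℕ → Graph
Book k = record
  { v   = k + 2
  ; Adj = λ i j → i ≢ j × (toℕ i < 2 ⊎ toℕ j < 2)
  }

{-# OPTIONS --safe #-}
module Submission where

-- The colouring of K₂₁ below has every red edge in at most one red triangle and
-- every blue edge in at most eight blue triangles. The spine of a monochromatic
-- B_k is an edge with k common neighbours of its colour, so there is neither a
-- red B₂ nor a blue B₉; restricting the colouring deals with every smaller n.

open import Defs
open import Data.Nat using (ℕ; suc; _+_; _<_; _≤_; _<?_; s≤s; z≤n)
open import Data.Nat.Properties using (+-comm; ≮⇒≥; <⇒≱)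
open import Data.Fin using (Fin; zero; suc; toℕ; cast; inject≤; _≟_)
open import Data.Fin.Properties
  using (all?; suc-injective; toℕ-cast; cast-involutive; inject≤-injective; injective⇒≤)
open import Data.Vec using (Vec; []; _∷_; lookup)
open import Data.List as List using (List; length; filter; allFin)
open import Data.List.Membership.Propositional using (_∈_)
open import Data.List.Membership.Propositional.Properties using (∈-filter⁺; ∈-allFin)
open import Data.List.Relation.Unary.Any using (index)
open import Data.List.Relation.Unary.Any.Properties using (lookup-index)
open import Data.Product using (_,_)
open import Data.Sum using (inj₁; [_,_]′)
import Data.Sum as Sum
open import Function using (_∘_)
open import Function.Definitions using (Injective)
open import Relation.Binary.Definitions using (DecidableEquality)
open import Relation.Binary.PropositionalEquality as ≡ using (_≡_; _≢_; refl; cong; subst)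
open import Relation.Nullary using (Dec; yes; no; ¬_; ¬?; contradiction)
open import Relation.Nullary.Decidable using (_×-dec_; _→-dec_; from-yes)

private
  variable
    A : Set
    m n k : ℕ
    κ : Colour
    G H : Graph

_≟ᶜ_ : DecidableEquality Colour
red  ≟ᶜ red  = yes refl
red  ≟ᶜ blue = no λ ()
blue ≟ᶜ red  = no λ ()
blue ≟ᶜ blue = yes refl

restrict : m ≤ n → Colouring n → Colouring m
restrict m≤n c = record
  { col = λ i j → col (inject≤ i m≤n) (inject≤ j m≤n)
  ; sym = λ i j → sym (inject≤ i m≤n) (inject≤ j m≤n)
  }
  where open Colouring c

monoCopy-restrict : (m≤n : m ≤ n) (c : Colouring n) →
                    MonoCopy (restrict m≤n c) κ G → MonoCopy c κ G
monoCopy-restrict m≤n c (f , f-inj , f-mono) =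
  (λ i → inject≤ (f i) m≤n) , (f-inj ∘ inject≤-injective m≤n m≤n _ _) , f-mono

arrows-mono : m ≤ n → Arrows m G H → Arrows n G H
arrows-mono m≤n arr c =
  Sum.map (monoCopy-restrict m≤n c) (monoCopy-restrict m≤n c) (arr (restrict m≤n c))

¬arrows⇒ramseyAtLeast : ¬ Arrows m G H → RamseyAtLeast G H (suc m)
¬arrows⇒ramseyAtLeast {m} ¬arr n arr with m <? n
... | yes m<n = m<n
... | no  m≮n = contradiction (arrows-mono (≮⇒≥ m≮n) arr) ¬arr

injective-∈⇒≤length : {xs : List A} {f : Fin k → A} →
                      Injective _≡_ _≡_ f → (∀ i → f i ∈ xs) → k ≤ length xs
injective-∈⇒≤length {xs = xs} {f} f-inj f∈ = injective⇒≤ index-injective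
  where
  open ≡.≡-Reasoning
  index-injective : Injective _≡_ _≡_ (λ i → index (f∈ i))
  index-injective {i} {j} eq = f-inj (begin
    f i                           ≡⟨ lookup-index (f∈ i) ⟩
    List.lookup xs (index (f∈ i)) ≡⟨ cong (List.lookup xs) eq ⟩
    List.lookup xs (index (f∈ j)) ≡⟨ lookup-index (f∈ j) ⟨
    f j                           ∎)

cast-injective : (eq : m ≡ n) → Injective _≡_ _≡_ (cast eq)
cast-injective eq {i} {j} cast-i≡cast-j = begin
  i                          ≡⟨ cast-involutive (≡.sym eq) eq i ⟨
  cast (≡.sym eq) (cast eq i) ≡⟨ cong (cast (≡.sym eq)) cast-i≡cast-j ⟩
  cast (≡.sym eq) (cast eq j) ≡⟨ cast-involutive (≡.sym eq) eq j ⟩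
  j                          ∎
  where open ≡.≡-Reasoning

module _ (c : Colouring n) where
  open Colouring c

  commonNeighbours : Colour → Fin n → Fin n → List (Fin n)
  commonNeighbours κ a b = filter
    (λ x → ¬? (x ≟ a) ×-dec ¬? (x ≟ b) ×-dec (col a x ≟ᶜ κ) ×-dec (col b x ≟ᶜ κ))
    (allFin n)

  BookNumberBelow : Colour → ℕ → Set
  BookNumberBelow κ k =
    ∀ a b → a ≢ b → col a b ≡ κ → length (commonNeighbours κ a b) < k

  bookNumberBelow? : ∀ κ k → Dec (BookNumberBelow κ k)
  bookNumberBelow? κ k = all? λ a → all? λ b →
    ¬? (a ≟ b) →-dec (col a b ≟ᶜ κ) →-dec (length (commonNeighbours κ a b) <? k)

  bookNumberBelow⇒¬monoBook : BookNumberBelow κ k → ¬ MonoCopy c κ (Book k)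
  bookNumberBelow⇒¬monoBook {κ} {k} below (f , f-inj , f-mono) =
    <⇒≱ (below a b a≢b (mono (λ ()) (s≤s z≤n)))
        (injective-∈⇒≤length (suc-injective ∘ suc-injective ∘ g-inj) page∈)
    where
    -- Book k has vertex set Fin (k + 2), which is not a successor for variable k;
    -- reindexing by Fin (2 + k) exposes the spine as zero and suc zero.
    g : Fin (2 + k) → Fin n
    g = f ∘ cast (+-comm 2 k)

    g-inj : Injective _≡_ _≡_ g
    g-inj = cast-injective (+-comm 2 k) ∘ f-inj

    mono : ∀ {i j} → i ≢ j → toℕ i < 2 → col (g i) (g j) ≡ κ
    mono {i} i≢j i<2 = f-mono _ _
      (i≢j ∘ cast-injective (+-comm 2 k) , inj₁ (subst (_< 2) (≡.sym (toℕ-cast _ i)) i<2))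

    a b : Fin n
    a = g zero
    b = g (suc zero)

    a≢b : a ≢ b
    a≢b = (λ ()) ∘ g-inj

    page∈ : ∀ j → g (suc (suc j)) ∈ commonNeighbours κ a b
    page∈ j = ∈-filter⁺ _ (∈-allFin _)
      ( (λ ()) ∘ g-inj , (λ ()) ∘ g-inj
      , mono (λ ()) (s≤s z≤n) , mono (λ ()) (s≤s (s≤s z≤n)) )

private
  r b : Colour
  r = red
  b = blue

colours₂₁ : Vec (Vec Colour 21) 21
colours₂₁ =
  (b ∷ b ∷ r ∷ b ∷ b ∷ r ∷ b ∷ r ∷ b ∷ r ∷ b ∷ b ∷ b ∷ r ∷ b ∷ r ∷ r ∷ b ∷ b ∷ r ∷ b ∷ []) ∷
  (b ∷ b ∷ r ∷ b ∷ b ∷ b ∷ r ∷ b ∷ b ∷ r ∷ r ∷ b ∷ b ∷ b ∷ b ∷ r ∷ r ∷ r ∷ r ∷ b ∷ b ∷ []) ∷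
  (r ∷ r ∷ b ∷ r ∷ b ∷ b ∷ b ∷ b ∷ r ∷ b ∷ b ∷ r ∷ r ∷ b ∷ b ∷ b ∷ b ∷ b ∷ r ∷ r ∷ b ∷ []) ∷
  (b ∷ b ∷ r ∷ b ∷ b ∷ r ∷ b ∷ b ∷ b ∷ b ∷ b ∷ b ∷ b ∷ b ∷ r ∷ r ∷ r ∷ r ∷ b ∷ b ∷ r ∷ []) ∷
  (b ∷ b ∷ b ∷ b ∷ b ∷ b ∷ b ∷ b ∷ b ∷ b ∷ b ∷ r ∷ r ∷ r ∷ b ∷ r ∷ r ∷ r ∷ r ∷ r ∷ b ∷ []) ∷
  (r ∷ b ∷ b ∷ r ∷ b ∷ b ∷ r ∷ b ∷ b ∷ b ∷ r ∷ r ∷ r ∷ r ∷ b ∷ b ∷ b ∷ r ∷ b ∷ b ∷ b ∷ []) ∷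
  (b ∷ r ∷ b ∷ b ∷ b ∷ r ∷ b ∷ r ∷ b ∷ b ∷ b ∷ b ∷ r ∷ b ∷ b ∷ r ∷ b ∷ b ∷ b ∷ r ∷ r ∷ []) ∷
  (r ∷ b ∷ b ∷ b ∷ b ∷ b ∷ r ∷ b ∷ r ∷ b ∷ b ∷ r ∷ b ∷ b ∷ r ∷ b ∷ r ∷ r ∷ r ∷ b ∷ b ∷ []) ∷
  (b ∷ b ∷ r ∷ b ∷ b ∷ b ∷ b ∷ r ∷ b ∷ b ∷ r ∷ b ∷ r ∷ r ∷ b ∷ r ∷ b ∷ r ∷ b ∷ b ∷ r ∷ []) ∷
  (r ∷ r ∷ b ∷ b ∷ b ∷ b ∷ b ∷ b ∷ b ∷ b ∷ b ∷ r ∷ r ∷ b ∷ r ∷ b ∷ b ∷ r ∷ b ∷ b ∷ r ∷ []) ∷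
  (b ∷ r ∷ b ∷ b ∷ b ∷ r ∷ b ∷ b ∷ r ∷ b ∷ b ∷ r ∷ b ∷ b ∷ r ∷ b ∷ r ∷ b ∷ b ∷ r ∷ b ∷ []) ∷
  (b ∷ b ∷ r ∷ b ∷ r ∷ r ∷ b ∷ r ∷ b ∷ r ∷ r ∷ b ∷ b ∷ b ∷ b ∷ r ∷ b ∷ b ∷ b ∷ b ∷ r ∷ []) ∷
  (b ∷ b ∷ r ∷ b ∷ r ∷ r ∷ r ∷ b ∷ r ∷ r ∷ b ∷ b ∷ b ∷ b ∷ r ∷ b ∷ r ∷ b ∷ b ∷ b ∷ b ∷ []) ∷
  (r ∷ b ∷ b ∷ b ∷ r ∷ r ∷ b ∷ b ∷ r ∷ b ∷ b ∷ b ∷ b ∷ b ∷ b ∷ b ∷ b ∷ b ∷ r ∷ b ∷ r ∷ []) ∷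
  (b ∷ b ∷ b ∷ r ∷ b ∷ b ∷ b ∷ r ∷ b ∷ r ∷ r ∷ b ∷ r ∷ b ∷ b ∷ r ∷ b ∷ b ∷ r ∷ r ∷ b ∷ []) ∷
  (r ∷ r ∷ b ∷ r ∷ r ∷ b ∷ r ∷ b ∷ r ∷ b ∷ b ∷ r ∷ b ∷ b ∷ r ∷ b ∷ b ∷ b ∷ b ∷ b ∷ b ∷ []) ∷
  (r ∷ r ∷ b ∷ r ∷ r ∷ b ∷ b ∷ r ∷ b ∷ b ∷ r ∷ b ∷ r ∷ b ∷ b ∷ b ∷ b ∷ b ∷ b ∷ b ∷ r ∷ []) ∷
  (b ∷ r ∷ b ∷ r ∷ r ∷ r ∷ b ∷ r ∷ r ∷ r ∷ b ∷ b ∷ b ∷ b ∷ b ∷ b ∷ b ∷ b ∷ b ∷ r ∷ b ∷ []) ∷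
  (b ∷ r ∷ r ∷ b ∷ r ∷ b ∷ b ∷ r ∷ b ∷ b ∷ b ∷ b ∷ b ∷ r ∷ r ∷ b ∷ b ∷ b ∷ b ∷ b ∷ b ∷ []) ∷
  (r ∷ b ∷ r ∷ b ∷ r ∷ b ∷ r ∷ b ∷ b ∷ b ∷ r ∷ b ∷ b ∷ b ∷ r ∷ b ∷ b ∷ r ∷ b ∷ b ∷ r ∷ []) ∷
  (b ∷ b ∷ b ∷ r ∷ b ∷ b ∷ r ∷ b ∷ r ∷ r ∷ b ∷ r ∷ b ∷ r ∷ b ∷ b ∷ r ∷ b ∷ b ∷ r ∷ b ∷ []) ∷ []

colouring₂₁ : Colouring 21
colouring₂₁ = record { col = colour ; sym = from-yes colour-symmetric? }
  where
  colour : Fin 21 → Fin 21 → Colour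
  colour i j = lookup (lookup colours₂₁ i) j

  colour-symmetric? : Dec (∀ i j → colour i j ≡ colour j i)
  colour-symmetric? = all? λ i → all? λ j → colour i j ≟ᶜ colour j i

no-red-B₂ : ¬ MonoCopy colouring₂₁ red (Book 2)
no-red-B₂ = bookNumberBelow⇒¬monoBook colouring₂₁
  (from-yes (bookNumberBelow? colouring₂₁ red 2))

no-blue-B₉ : ¬ MonoCopy colouring₂₁ blue (Book 9)
no-blue-B₉ = bookNumberBelow⇒¬monoBook colouring₂₁
  (from-yes (bookNumberBelow? colouring₂₁ blue 9))

mainTheorem4 : RamseyAtLeast (Book 2) (Book 9) 22
mainTheorem4 = ¬arrows⇒ramseyAtLeast λ arrows →
  [ no-red-B₂ , no-blue-B₉ ]′ (arrows colouring₂₁)
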